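{- Let $a,b$ be integers with $a\ge 0$, $a^2+4b=4$ and $(a,b)\neq(0,1)$, and let $G\in\mathscr{G}(a,b)$. Then every equitable partition of $G$ has at least three cells.
   Context: Graphs are finite, simple and undirected; eigenvalues are those of the adjacency matrix. An eigenvalue of $G$ is main if it has an eigenvector with nonzero entry sum. For integers $a,b$, $\mathscr{G}(a,b)$ is the set of connected graphs with exactly two main eigenvalues satisfying $\sum_{u\in N(v)}d(u)=a\,d(v)+b$ for every vertex $v$. A partition $V(G)=C_1\cup\cdots\cup C_r$ into nonempty cells is equitable if for all $i,j$ the number of neighbours in $C_j$ of a vertex $u\in C_i$ depends only on $i,j$. -}

module Defs where

open import Data.Nat as ℕ using (ℕ; zero; suc)
open import Data.Fin using (Fin; zero; suc)
open import Data.Fin.Properties using () renaming (_≟_ to _≟ᶠ_)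
open import Data.Bool using (Bool; true; false; if_then_else_; _∧_)
open import Data.Integer as ℤ using (ℤ)
open import Data.Rational as ℚ using (ℚ; 0ℚ; 1ℚ)
open import Data.Product using (Σ; ∃; _×_; _,_)
open import Data.Sum using (_⊎_)
open import Relation.Nullary using (¬_; does)
open import Relation.Binary.PropositionalEquality using (_≡_; _≢_)

∑ℕ : (n : ℕ) → (Fin n → ℕ) → ℕ
∑ℕ zero    f = 0
∑ℕ (suc n) f = f zero ℕ.+ ∑ℕ n (λ i → f (suc i))

∑ℚ : (n : ℕ) → (Fin n → ℚ) → ℚ
∑ℚ zero    f = 0ℚ
∑ℚ (suc n) f = f zero ℚ.+ ∑ℚ n (λ i → f (suc i))

record Graph (n : ℕ) : Set where
  field
    adj    : Fin n → Fin n → Bool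
    sym    : ∀ i j → adj i j ≡ adj j i
    irrefl : ∀ i → adj i i ≡ false
open Graph public

deg : ∀ {n} → Graph n → Fin n → ℕ
deg {n} G v = ∑ℕ n (λ u → if adj G v u then 1 else 0)

nbrDegSum : ∀ {n} → Graph n → Fin n → ℕ
nbrDegSum {n} G v = ∑ℕ n (λ u → if adj G v u then deg G u else 0)

data Reach {n} (G : Graph n) (u : Fin n) : Fin n → Set where
  here : Reach G u u
  step : ∀ {w v} → Reach G u w → adj G w v ≡ true → Reach G u v

Connected : ∀ {n} → Graph n → Set
Connected {n} G = ∀ (u v : Fin n) → Reach G u v

A : ∀ {n} → Graph n → Fin n → Fin n → ℚ
A G i j = if adj G i j then 1ℚ else 0ℚ

IsEigen : ∀ {n} → Graph n → ℚ → (Fin n → ℚ) → Set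
IsEigen {n} G λ′ x = ∀ i → ∑ℚ n (λ j → A G i j ℚ.* x j) ≡ λ′ ℚ.* x i

-- λ is a main eigenvalue: it has an eigenvector with nonzero entry sum
-- (a vector with nonzero entry sum is automatically nonzero).
IsMain : ∀ {n} → Graph n → ℚ → Set
IsMain {n} G λ′ = Σ (Fin n → ℚ) λ x → IsEigen G λ′ x × ∑ℚ n x ≢ 0ℚ

TwoMain : ∀ {n} → Graph n → Set
TwoMain G = Σ ℚ λ λ₁ → Σ ℚ λ λ₂ →
  λ₁ ≢ λ₂ × IsMain G λ₁ × IsMain G λ₂ ×
  (∀ μ → IsMain G μ → μ ≡ λ₁ ⊎ μ ≡ λ₂)

InG : ∀ {n} → ℤ → ℤ → Graph n → Set
InG {n} a b G =
  Connected G × TwoMain G ×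
  (∀ v → ℤ.+ (nbrDegSum G v) ≡ a ℤ.* ℤ.+ (deg G v) ℤ.+ b)

nbrsIn : ∀ {n r} → Graph n → (Fin n → Fin r) → Fin n → Fin r → ℕ
nbrsIn {n} G c u j = ∑ℕ n (λ w → if adj G u w ∧ does (c w ≟ᶠ j) then 1 else 0)

IsEquitable : ∀ {n r} → Graph n → (Fin n → Fin r) → Set
IsEquitable {n} {r} G c =
  (∀ (k : Fin r) → ∃ λ u → c u ≡ k) ×
  (∀ u v → c u ≡ c v → ∀ j → nbrsIn G c u j ≡ nbrsIn G c v j)

{-# OPTIONS --safe #-}
-- A regular graph has a single main eigenvalue, its degree, because 𝟏ᵀA = d 𝟏ᵀ; so a graph
-- with two main eigenvalues has no equitable partition with at most one cell. For two cells,
-- let B = [[p, q], [s, t]] be the quotient matrix and d = B𝟏 the vector of cell degrees; the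
-- defining condition of 𝒢(a,b) reads B d = a d + b 𝟏. As d is not constant this forces
-- a = p + t, and then a² + 4b = (p - t)² + 4qs. Connectivity gives q, s ≥ 1, so a² + 4b = 4
-- forces p = t and q = s = 1, which makes d constant after all.
module Submission where

open import Defs
open import Data.Nat using (ℕ; _≤_)
open import Data.Fin using (Fin)
open import Data.Integer using (ℤ; +_; _*_; _+_)
open import Data.Product using (_×_)
open import Relation.Nullary using (¬_)
open import Relation.Binary.PropositionalEquality using (_≡_)

open import Algebra.Bundles using (CommutativeRing)
open import Data.Bool using (Bool; true; false; if_then_else_; _∧_)
open import Data.Empty using (⊥-elim)
open import Data.Fin using (zero; suc)
open import Data.Fin.Patterns using (0F; 1F)
open import Data.Fin.Properties using (_≟_)
open import Data.Integer using (∣_∣; _-_; 0ℤ; +[1+_]; -[1+_])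
open import Data.Nat using (zero; suc; z≤n; s≤s)
open import Data.Product using (∃; ∃₂; _,_; proj₁; proj₂)
open import Data.Rational using (ℚ; 0ℚ; 1ℚ; 1/_; ≢-nonZero)
open import Data.Sum using (_⊎_; inj₁; inj₂; [_,_]′)
open import Function using (_∘_; id)
open import Relation.Nullary using (does; yes; no)
open import Relation.Nullary.Decidable using (dec-true)
open import Relation.Binary.PropositionalEquality
  using (_≢_; _≗_; refl; trans; cong; cong₂; subst; module ≡-Reasoning)
import Relation.Binary.PropositionalEquality as ≡
import Algebra.Properties.Semiring.Sum as SemiringSum
import Data.Integer.Properties as ℤ
open import Data.Integer.Tactic.RingSolver using (solve-∀)
import Data.Nat as ℕ
import Data.Nat.Properties as ℕ
import Data.Rational as ℚ
import Data.Rational.Properties as ℚ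
open import Algebra.Definitions.RawMonoid ℚ.+-0-rawMonoid using () renaming (_×_ to _×ℚ_)

open ≡-Reasoning

module ℕ∑ = SemiringSum ℕ.+-*-semiring
module ℚ∑ = SemiringSum (CommutativeRing.semiring ℚ.+-*-commutativeRing)

∑ℕ≡sum : ∀ n (f : Fin n → ℕ) → ∑ℕ n f ≡ ℕ∑.sum f
∑ℕ≡sum zero    f = refl
∑ℕ≡sum (suc n) f = cong (f zero ℕ.+_) (∑ℕ≡sum n (f ∘ suc))

∑ℚ≡sum : ∀ n (f : Fin n → ℚ) → ∑ℚ n f ≡ ℚ∑.sum f
∑ℚ≡sum zero    f = refl
∑ℚ≡sum (suc n) f = cong (f zero ℚ.+_) (∑ℚ≡sum n (f ∘ suc))

∑ℕ-cong : ∀ n {f g : Fin n → ℕ} → f ≗ g → ∑ℕ n f ≡ ∑ℕ n g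
∑ℕ-cong n {f} {g} f≗g =
  trans (∑ℕ≡sum n f) (trans (ℕ∑.sum-cong-≗ f≗g) (≡.sym (∑ℕ≡sum n g)))

∑ℕ-2 : (f : Fin 2 → ℕ) → ∑ℕ 2 f ≡ f zero ℕ.+ f (suc zero)
∑ℕ-2 f = cong (f zero ℕ.+_) (ℕ.+-identityʳ _)

∑ℕ≡0⇒≡0 : ∀ n (f : Fin n → ℕ) → ∑ℕ n f ≡ 0 → ∀ i → f i ≡ 0
∑ℕ≡0⇒≡0 (suc n) f ∑≡0 zero    = ℕ.m+n≡0⇒m≡0 (f zero) ∑≡0
∑ℕ≡0⇒≡0 (suc n) f ∑≡0 (suc i) = ∑ℕ≡0⇒≡0 n (f ∘ suc) (ℕ.m+n≡0⇒n≡0 (f zero) ∑≡0) i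

sum-δ : ∀ {r} (x : Fin r) (g : Fin r → ℕ) →
  ℕ∑.sum (λ j → (if does (x ≟ j) then 1 else 0) ℕ.* g j) ≡ g x
sum-δ {suc r} zero    g = trans
  (cong₂ ℕ._+_ (ℕ.+-identityʳ (g zero)) (ℕ∑.sum-replicate-zero r))
  (ℕ.+-identityʳ (g zero))
sum-δ         (suc x) g = sum-δ x (g ∘ suc)

sum-select : ∀ {r} b (x : Fin r) (g : Fin r → ℕ) →
  ℕ∑.sum (λ j → (if b ∧ does (x ≟ j) then 1 else 0) ℕ.* g j) ≡ (if b then g x else 0)
sum-select {r} false x g = ℕ∑.sum-replicate-zero r
sum-select     true  x g = sum-δ x g

∑ℚ-indicator : ∀ n (b : Fin n → Bool) →
  ∑ℚ n (λ i → if b i then 1ℚ else 0ℚ) ≡ ∑ℕ n (λ i → if b i then 1 else 0) ×ℚ 1ℚ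
∑ℚ-indicator zero    b = refl
∑ℚ-indicator (suc n) b with b zero
... | true  = cong (1ℚ ℚ.+_) (∑ℚ-indicator n (b ∘ suc))
... | false = trans (ℚ.+-identityˡ _) (∑ℚ-indicator n (b ∘ suc))

*-cancelʳ-≢0 : ∀ p q r → r ≢ 0ℚ → p ℚ.* r ≡ q ℚ.* r → p ≡ q
*-cancelʳ-≢0 p q r r≢0 pr≡qr = begin
  p                    ≡⟨ ≡.sym (divide p) ⟩
  p ℚ.* r ℚ.* (1/ r)   ≡⟨ cong (ℚ._* (1/ r)) pr≡qr ⟩
  q ℚ.* r ℚ.* (1/ r)   ≡⟨ divide q ⟩
  q                    ∎
  where
  instance
    r-nonZero : ℚ.NonZero r
    r-nonZero = ≢-nonZero r≢0
  divide : ∀ x → x ℚ.* r ℚ.* (1/ r) ≡ x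
  divide x = begin
    x ℚ.* r ℚ.* (1/ r)   ≡⟨ ℚ.*-assoc x r (1/ r) ⟩
    x ℚ.* (r ℚ.* 1/ r)   ≡⟨ cong (x ℚ.*_) (ℚ.*-inverseʳ r) ⟩
    x ℚ.* 1ℚ             ≡⟨ ℚ.*-identityʳ x ⟩
    x                    ∎

Regular : ∀ {n} → Graph n → ℕ → Set
Regular {n} G d = ∀ (v : Fin n) → deg G v ≡ d

columnSum≡deg : ∀ {n} (G : Graph n) j → ℚ∑.sum (λ i → A G i j) ≡ deg G j ×ℚ 1ℚ
columnSum≡deg {n} G j = begin
  ℚ∑.sum (λ i → A G i j)
    ≡⟨ ℚ∑.sum-cong-≗ (λ i → cong (λ e → if e then 1ℚ else 0ℚ) (sym G i j)) ⟩
  ℚ∑.sum (A G j)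
    ≡⟨ ∑ℚ≡sum n (A G j) ⟨
  ∑ℚ n (A G j)
    ≡⟨ ∑ℚ-indicator n (adj G j) ⟩
  deg G j ×ℚ 1ℚ
    ∎

main≡degree : ∀ {n} (G : Graph n) {d μ} → Regular G d → IsMain G μ → μ ≡ d ×ℚ 1ℚ
main≡degree {n} G {d} {μ} regular (x , Ax≡μx , ∑x≢0) =
  *-cancelʳ-≢0 μ (d ×ℚ 1ℚ) (ℚ∑.sum x) (∑x≢0 ∘ trans (∑ℚ≡sum n x)) (begin
    μ ℚ.* ℚ∑.sum x
      ≡⟨ ℚ∑.*-distribˡ-sum μ x ⟩
    ℚ∑.sum (λ i → μ ℚ.* x i)
      ≡⟨ ℚ∑.sum-cong-≗ eigen ⟨
    ℚ∑.sum (λ i → ℚ∑.sum (λ j → A G i j ℚ.* x j))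
      ≡⟨ ℚ∑.∑-comm {n} {n} _ ⟩
    ℚ∑.sum (λ j → ℚ∑.sum (λ i → A G i j ℚ.* x j))
      ≡⟨ ℚ∑.sum-cong-≗ (λ j → ℚ∑.*-distribʳ-sum (x j) (λ i → A G i j)) ⟨
    ℚ∑.sum (λ j → ℚ∑.sum (λ i → A G i j) ℚ.* x j)
      ≡⟨ ℚ∑.sum-cong-≗ (λ j → cong (ℚ._* x j) (columnSum≡deg G j)) ⟩
    ℚ∑.sum (λ j → deg G j ×ℚ 1ℚ ℚ.* x j)
      ≡⟨ ℚ∑.sum-cong-≗ (λ j → cong (λ k → k ×ℚ 1ℚ ℚ.* x j) (regular j)) ⟩
    ℚ∑.sum (λ j → d ×ℚ 1ℚ ℚ.* x j)
      ≡⟨ ℚ∑.*-distribˡ-sum (d ×ℚ 1ℚ) x ⟨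
    d ×ℚ 1ℚ ℚ.* ℚ∑.sum x
      ∎)
  where
  eigen : ∀ i → ℚ∑.sum (λ j → A G i j ℚ.* x j) ≡ μ ℚ.* x i
  eigen i = trans (≡.sym (∑ℚ≡sum n _)) (Ax≡μx i)

twoMain⇒irregular : ∀ {n} (G : Graph n) {d} → TwoMain G → ¬ Regular G d
twoMain⇒irregular G (λ₁ , λ₂ , λ₁≢λ₂ , main₁ , main₂ , _) regular =
  λ₁≢λ₂ (trans (main≡degree G regular main₁) (≡.sym (main≡degree G regular main₂)))

module _ {n r} (G : Graph n) (c : Fin n → Fin r) where

  ∑nbrs≡∑nbrsIn : ∀ (g : Fin r → ℕ) v →
    ∑ℕ n (λ w → if adj G v w then g (c w) else 0) ≡ ∑ℕ r (λ j → nbrsIn G c v j ℕ.* g j)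
  ∑nbrs≡∑nbrsIn g v = begin
    ∑ℕ n (λ w → if adj G v w then g (c w) else 0)
      ≡⟨ ∑ℕ≡sum n _ ⟩
    ℕ∑.sum (λ w → if adj G v w then g (c w) else 0)
      ≡⟨ ℕ∑.sum-cong-≗ (λ w → sum-select (adj G v w) (c w) g) ⟨
    ℕ∑.sum (λ w → ℕ∑.sum (λ j → indicator w j ℕ.* g j))
      ≡⟨ ℕ∑.∑-comm {n} {r} _ ⟩
    ℕ∑.sum (λ j → ℕ∑.sum (λ w → indicator w j ℕ.* g j))
      ≡⟨ ℕ∑.sum-cong-≗ (λ j → ℕ∑.*-distribʳ-sum (g j) (λ w → indicator w j)) ⟨
    ℕ∑.sum (λ j → ℕ∑.sum (λ w → indicator w j) ℕ.* g j)
      ≡⟨ ℕ∑.sum-cong-≗ (λ j → cong (ℕ._* g j) (∑ℕ≡sum n _)) ⟨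
    ℕ∑.sum (λ j → nbrsIn G c v j ℕ.* g j)
      ≡⟨ ∑ℕ≡sum r _ ⟨
    ∑ℕ r (λ j → nbrsIn G c v j ℕ.* g j)
      ∎
    where
    indicator : Fin n → Fin r → ℕ
    indicator w j = if adj G v w ∧ does (c w ≟ j) then 1 else 0

  deg≡∑nbrsIn : ∀ v → deg G v ≡ ∑ℕ r (nbrsIn G c v)
  deg≡∑nbrsIn v = trans (∑nbrs≡∑nbrsIn (λ _ → 1) v) (∑ℕ-cong r (λ j → ℕ.*-identityʳ _))

  adj⇒nbrsIn≢0 : ∀ {w x} → adj G w x ≡ true → nbrsIn G c w (c x) ≢ 0
  adj⇒nbrsIn≢0 {w} {x} wx nbrsIn≡0 = ℕ.1+n≢0 (begin
    1
      ≡⟨ cong₂ (λ e d → if e ∧ d then 1 else 0) wx (dec-true (c x ≟ c x) refl) ⟨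
    (if adj G w x ∧ does (c x ≟ c x) then 1 else 0)
      ≡⟨ ∑ℕ≡0⇒≡0 n _ nbrsIn≡0 x ⟩
    0
      ∎)

  reach⇒edgeLeavingCell : ∀ {i u v} → Reach G u v → c u ≡ i → c v ≢ i →
    ∃₂ λ w x → c w ≡ i × c x ≢ i × adj G w x ≡ true
  reach⇒edgeLeavingCell here              cu≡i cv≢i = ⊥-elim (cv≢i cu≡i)
  reach⇒edgeLeavingCell {i} (step {w} {x} u⇝w wx) cu≡i cx≢i with c w ≟ i
  ... | yes cw≡i = w , x , cw≡i , cx≢i , wx
  ... | no  cw≢i = reach⇒edgeLeavingCell u⇝w cu≡i cw≢i

module EquitablePartition {n r} (G : Graph n) (c : Fin n → Fin r) (equitable : IsEquitable G c) where

  rep : Fin r → Fin n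
  rep i = proj₁ (proj₁ equitable i)

  rep-cell : ∀ i → c (rep i) ≡ i
  rep-cell i = proj₂ (proj₁ equitable i)

  quotient : Fin r → Fin r → ℕ
  quotient i = nbrsIn G c (rep i)

  cellDeg : Fin r → ℕ
  cellDeg i = deg G (rep i)

  nbrsIn≡quotient : ∀ {v i} → c v ≡ i → nbrsIn G c v ≗ quotient i
  nbrsIn≡quotient {v} {i} cv≡i = proj₂ equitable v (rep i) (trans cv≡i (≡.sym (rep-cell i)))

  cellDeg≡∑quotient : ∀ i → cellDeg i ≡ ∑ℕ r (quotient i)
  cellDeg≡∑quotient i = deg≡∑nbrsIn G c (rep i)

  deg≡cellDeg : ∀ v → deg G v ≡ cellDeg (c v)
  deg≡cellDeg v = begin
    deg G v                  ≡⟨ deg≡∑nbrsIn G c v ⟩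
    ∑ℕ r (nbrsIn G c v)      ≡⟨ ∑ℕ-cong r (nbrsIn≡quotient refl) ⟩
    ∑ℕ r (quotient (c v))    ≡⟨ cellDeg≡∑quotient (c v) ⟨
    cellDeg (c v)            ∎

  nbrDegSum≡quotient·cellDeg : ∀ i →
    nbrDegSum G (rep i) ≡ ∑ℕ r (λ j → quotient i j ℕ.* cellDeg j)
  nbrDegSum≡quotient·cellDeg i =
    trans (∑ℕ-cong n (λ w → cong (λ d → if adj G (rep i) w then d else 0) (deg≡cellDeg w)))
          (∑nbrs≡∑nbrsIn G c cellDeg (rep i))

  equalCellDegrees⇒regular : ∀ {d} → (∀ i → cellDeg i ≡ d) → Regular G d
  equalCellDegrees⇒regular cellDeg≡d v = trans (deg≡cellDeg v) (cellDeg≡d (c v))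

  connected⇒quotientExit : Connected G → ∀ {i v} → c v ≢ i →
    ∃ λ j → j ≢ i × quotient i j ≢ 0
  connected⇒quotientExit connected {i} {v} cv≢i
    with reach⇒edgeLeavingCell G c (connected (rep i) v) (rep-cell i) cv≢i
  ... | w , x , cw≡i , cx≢i , wx =
    c x , cx≢i , subst (_≢ 0) (nbrsIn≡quotient cw≡i (c x)) (adj⇒nbrsIn≢0 G c wx)

m*m+4*k≡4⇒m≡0×k≡1 : ∀ m k → m ℕ.* m ℕ.+ 4 ℕ.* k ≡ 4 → k ≢ 0 → m ≡ 0 × k ≡ 1
m*m+4*k≡4⇒m≡0×k≡1 m k sum≡4 k≢0 = m≡0 , k≡1
  where
  4*k≤4 : 4 ℕ.* k ≤ 4
  4*k≤4 = subst (4 ℕ.* k ≤_) sum≡4 (ℕ.m≤n+m (4 ℕ.* k) (m ℕ.* m))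
  k≡1 : k ≡ 1
  k≡1 = ℕ.≤-antisym (ℕ.*-cancelˡ-≤ 4 4*k≤4) (ℕ.n≢0⇒n>0 k≢0)
  m*m≡0 : m ℕ.* m ≡ 0
  m*m≡0 = ℕ.+-cancelʳ-≡ 4 (m ℕ.* m) 0 (subst (λ k → m ℕ.* m ℕ.+ 4 ℕ.* k ≡ 4) k≡1 sum≡4)
  m≡0 : m ≡ 0
  m≡0 = [ id , id ]′ (ℕ.m*n≡0⇒m≡0∨n≡0 m m*m≡0)

i*i≡∣i∣*∣i∣ : ∀ i → i * i ≡ + (∣ i ∣ ℕ.* ∣ i ∣)
i*i≡∣i∣*∣i∣ (+ zero) = refl
i*i≡∣i∣*∣i∣ +[1+ m ] = refl
i*i≡∣i∣*∣i∣ -[1+ m ] = refl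

rowEquations⇒trace⊎equalRowSums : ∀ (a b p q s t : ℤ) →
  p * (p + q) + q * (s + t) ≡ a * (p + q) + b →
  s * (p + q) + t * (s + t) ≡ a * (s + t) + b →
  a ≡ p + t ⊎ p + q ≡ s + t
rowEquations⇒trace⊎equalRowSums a b p q s t row₀ row₁
  with ℤ.i*j≡0⇒i≡0∨j≡0 (p + t - a) product≡0
  where
  identity : ∀ a b p q s t →
    (p + t - a) * ((s + t) - (p + q)) ≡
    (s * (p + q) + t * (s + t) - (a * (s + t) + b)) - (p * (p + q) + q * (s + t) - (a * (p + q) + b))
  identity = solve-∀
  product≡0 : (p + t - a) * ((s + t) - (p + q)) ≡ 0ℤ
  product≡0 =
    trans (identity a b p q s t) (cong₂ _-_ (ℤ.i≡j⇒i-j≡0 row₁) (ℤ.i≡j⇒i-j≡0 row₀))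
... | inj₁ trace-a≡0     = inj₁ (≡.sym (ℤ.i-j≡0⇒i≡j _ _ trace-a≡0))
... | inj₂ rowSumsDiff≡0 = inj₂ (≡.sym (ℤ.i-j≡0⇒i≡j _ _ rowSumsDiff≡0))

trace⇒discriminant : ∀ (a b p q s t : ℤ) → a ≡ p + t →
  p * (p + q) + q * (s + t) ≡ a * (p + q) + b →
  (p - t) * (p - t) + + 4 * (q * s) ≡ a * a + + 4 * b
trace⇒discriminant .(p + t) b p q s t refl row₀ = begin
  (p - t) * (p - t) + + 4 * (q * s)
    ≡⟨ identity b p q s t ⟩
  (p + t) * (p + t) + + 4 * b + + 4 * (row₀-lhs - row₀-rhs)
    ≡⟨ cong (λ z → (p + t) * (p + t) + + 4 * b + + 4 * z) (ℤ.i≡j⇒i-j≡0 row₀) ⟩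
  (p + t) * (p + t) + + 4 * b + 0ℤ
    ≡⟨ ℤ.+-identityʳ _ ⟩
  (p + t) * (p + t) + + 4 * b
    ∎
  where
  row₀-lhs = p * (p + q) + q * (s + t)
  row₀-rhs = (p + t) * (p + q) + b
  identity : ∀ b p q s t →
    (p - t) * (p - t) + + 4 * (q * s) ≡
    (p + t) * (p + t) + + 4 * b + + 4 * ((p * (p + q) + q * (s + t)) - ((p + t) * (p + q) + b))
  identity = solve-∀

twoRowQuotient⇒equalRowSums : ∀ (a b : ℤ) (p q s t : ℕ) →
  a * a + + 4 * b ≡ + 4 → q ≢ 0 → s ≢ 0 →
  + (p ℕ.* (p ℕ.+ q) ℕ.+ q ℕ.* (s ℕ.+ t)) ≡ a * + (p ℕ.+ q) + b →
  + (s ℕ.* (p ℕ.+ q) ℕ.+ t ℕ.* (s ℕ.+ t)) ≡ a * + (s ℕ.+ t) + b →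
  p ℕ.+ q ≡ s ℕ.+ t
twoRowQuotient⇒equalRowSums a b p q s t disc q≢0 s≢0 row₀ row₁ = equalRowSums
  (rowEquations⇒trace⊎equalRowSums a b (+ p) (+ q) (+ s) (+ t) (toℤ p q p q row₀) (toℤ s t s t row₁))
  where
  toℤ : ∀ x y u v → + (x ℕ.* (p ℕ.+ q) ℕ.+ y ℕ.* (s ℕ.+ t)) ≡ a * + (u ℕ.+ v) + b →
    + x * (+ p + + q) + + y * (+ s + + t) ≡ a * (+ u + + v) + b
  toℤ x y u v row = begin
    + x * (+ p + + q) + + y * (+ s + + t)
      ≡⟨ cong₂ (λ d₀ d₁ → + x * d₀ + + y * d₁) (ℤ.pos-+ p q) (ℤ.pos-+ s t) ⟨
    + x * + (p ℕ.+ q) + + y * + (s ℕ.+ t)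
      ≡⟨ cong₂ _+_ (ℤ.pos-* x _) (ℤ.pos-* y _) ⟨
    + (x ℕ.* (p ℕ.+ q)) + + (y ℕ.* (s ℕ.+ t))
      ≡⟨ ℤ.pos-+ (x ℕ.* (p ℕ.+ q)) _ ⟨
    + (x ℕ.* (p ℕ.+ q) ℕ.+ y ℕ.* (s ℕ.+ t))
      ≡⟨ row ⟩
    a * + (u ℕ.+ v) + b
      ≡⟨ cong (λ d → a * d + b) (ℤ.pos-+ u v) ⟩
    a * (+ u + + v) + b
      ∎

  equalRowSums : a ≡ + p + + t ⊎ + p + + q ≡ + s + + t → p ℕ.+ q ≡ s ℕ.+ t
  equalRowSums (inj₂ rowSums≡) =
    ℤ.+-injective (trans (ℤ.pos-+ p q) (trans rowSums≡ (≡.sym (ℤ.pos-+ s t))))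
  equalRowSums (inj₁ a≡trace) = begin
    p ℕ.+ q   ≡⟨ cong₂ ℕ._+_ p≡t (ℕ.m*n≡1⇒m≡1 q s qs≡1) ⟩
    t ℕ.+ 1   ≡⟨ ℕ.+-comm t 1 ⟩
    1 ℕ.+ t   ≡⟨ cong (ℕ._+ t) (ℕ.m*n≡1⇒n≡1 q s qs≡1) ⟨
    s ℕ.+ t   ∎
    where
    x = + p - + t
    discriminant≡4 : ∣ x ∣ ℕ.* ∣ x ∣ ℕ.+ 4 ℕ.* (q ℕ.* s) ≡ 4
    discriminant≡4 = ℤ.+-injective (begin
      + (∣ x ∣ ℕ.* ∣ x ∣ ℕ.+ 4 ℕ.* (q ℕ.* s))
        ≡⟨ ℤ.pos-+ (∣ x ∣ ℕ.* ∣ x ∣) (4 ℕ.* (q ℕ.* s)) ⟩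
      + (∣ x ∣ ℕ.* ∣ x ∣) + + (4 ℕ.* (q ℕ.* s))
        ≡⟨ cong₂ _+_ (≡.sym (i*i≡∣i∣*∣i∣ x)) (trans (ℤ.pos-* 4 (q ℕ.* s)) (cong (+ 4 *_) (ℤ.pos-* q s))) ⟩
      x * x + + 4 * (+ q * + s)
        ≡⟨ trace⇒discriminant a b (+ p) (+ q) (+ s) (+ t) a≡trace (toℤ p q p q row₀) ⟩
      a * a + + 4 * b
        ≡⟨ disc ⟩
      + 4
        ∎)
    qs≢0 : q ℕ.* s ≢ 0
    qs≢0 qs≡0 = [ q≢0 , s≢0 ]′ (ℕ.m*n≡0⇒m≡0∨n≡0 q qs≡0)
    ∣x∣≡0×qs≡1 : ∣ x ∣ ≡ 0 × q ℕ.* s ≡ 1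
    ∣x∣≡0×qs≡1 = m*m+4*k≡4⇒m≡0×k≡1 ∣ x ∣ (q ℕ.* s) discriminant≡4 qs≢0
    p≡t : p ≡ t
    p≡t = ℤ.+-injective (ℤ.i-j≡0⇒i≡j (+ p) (+ t) (ℤ.∣i∣≡0⇒i≡0 (proj₁ ∣x∣≡0×qs≡1)))
    qs≡1 : q ℕ.* s ≡ 1
    qs≡1 = proj₂ ∣x∣≡0×qs≡1

twoCells⇒equalCellDegrees : ∀ (a b : ℤ) {n} (G : Graph n) →
  a * a + + 4 * b ≡ + 4 → InG a b G →
  (c : Fin n → Fin 2) (equitable : IsEquitable G c) →
  let open EquitablePartition G c equitable in cellDeg 0F ≡ cellDeg 1F
twoCells⇒equalCellDegrees a b G disc (connected , _ , nbrDegSum≡) c equitable = begin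
  cellDeg 0F
    ≡⟨ rowSum 0F ⟩
  p ℕ.+ q
    ≡⟨ twoRowQuotient⇒equalRowSums a b p q s t disc q≢0 s≢0 (rowEquation 0F) (rowEquation 1F) ⟩
  s ℕ.+ t
    ≡⟨ rowSum 1F ⟨
  cellDeg 1F
    ∎
  where
  open EquitablePartition G c equitable
  p = quotient 0F 0F
  q = quotient 0F 1F
  s = quotient 1F 0F
  t = quotient 1F 1F

  rowSum : ∀ i → cellDeg i ≡ quotient i 0F ℕ.+ quotient i 1F
  rowSum i = trans (cellDeg≡∑quotient i) (∑ℕ-2 (quotient i))

  rowEquation : ∀ i →
    + (quotient i 0F ℕ.* (p ℕ.+ q) ℕ.+ quotient i 1F ℕ.* (s ℕ.+ t)) ≡
    a * + (quotient i 0F ℕ.+ quotient i 1F) + b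
  rowEquation i = begin
    + (quotient i 0F ℕ.* (p ℕ.+ q) ℕ.+ quotient i 1F ℕ.* (s ℕ.+ t))
      ≡⟨ cong₂ (λ d₀ d₁ → + (quotient i 0F ℕ.* d₀ ℕ.+ quotient i 1F ℕ.* d₁)) (rowSum 0F) (rowSum 1F) ⟨
    + (quotient i 0F ℕ.* cellDeg 0F ℕ.+ quotient i 1F ℕ.* cellDeg 1F)
      ≡⟨ cong +_ (trans (nbrDegSum≡quotient·cellDeg i) (∑ℕ-2 λ j → quotient i j ℕ.* cellDeg j)) ⟨
    + nbrDegSum G (rep i)
      ≡⟨ nbrDegSum≡ (rep i) ⟩
    a * + cellDeg i + b
      ≡⟨ cong (λ d → a * + d + b) (rowSum i) ⟩
    a * + (quotient i 0F ℕ.+ quotient i 1F) + b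
      ∎

  q≢0 : q ≢ 0
  q≢0 with connected⇒quotientExit connected {0F} {rep 1F} ((λ ()) ∘ trans (≡.sym (rep-cell 1F)))
  ... | 1F , _   , q≢0 = q≢0
  ... | 0F , 0≢0 , _   = ⊥-elim (0≢0 refl)

  s≢0 : s ≢ 0
  s≢0 with connected⇒quotientExit connected {1F} {rep 0F} ((λ ()) ∘ trans (≡.sym (rep-cell 0F)))
  ... | 0F , _   , s≢0 = s≢0
  ... | 1F , 1≢1 , _   = ⊥-elim (1≢1 refl)

proposition2p10 : (a b : ℤ) → (+ 0) Data.Integer.≤ a → a * a + (+ 4) * b ≡ + 4 →
    ¬ (a ≡ + 0 × b ≡ + 1) →
    (n : ℕ) (G : Graph n) → InG a b G →
    (r : ℕ) (c : Fin n → Fin r) → IsEquitable G c → 3 ≤ r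
proposition2p10 _ _ _ _ _ _ G (_ , twoMain , _) 0 c equitable =
  ⊥-elim (twoMain⇒irregular G twoMain (equalCellDegrees⇒regular {0} (λ ())))
  where open EquitablePartition G c equitable
proposition2p10 _ _ _ _ _ _ G (_ , twoMain , _) 1 c equitable =
  ⊥-elim (twoMain⇒irregular G twoMain (equalCellDegrees⇒regular λ { 0F → refl }))
  where open EquitablePartition G c equitable
proposition2p10 a b _ disc _ _ G inG@(_ , twoMain , _) 2 c equitable =
  ⊥-elim (twoMain⇒irregular G twoMain (equalCellDegrees⇒regular λ
    { 0F → refl
    ; 1F → ≡.sym (twoCells⇒equalCellDegrees a b G disc inG c equitable) }))
  where open EquitablePartition G c equitable
proposition2p10 _ _ _ _ _ _ _ _ (suc (suc (suc _))) _ _ = s≤s (s≤s (s≤s z≤n))
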